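{- Let $G=((X,Y),E)$ be a split graph with $\sigma(G)=2$, and let $P$ be its set of pendant vertices. Let $A$ be the set of vertices $a$ with $d(a)=\Delta(G)$ that are universal in $G[V\setminus P]$. If every $a\in A$ is adjacent to at least one pendant vertex, then $G$ is Class 1.
   Context: All graphs are simple, finite, connected and undirected. A split graph $G=((X,Y),E)$ is a graph whose vertex set is partitioned into a clique $X$ and an independent set $Y$; $X$ is taken to be a maximal clique. A tree $t$-spanner of a connected graph $G$ is a spanning tree $T$ of $G$ with $d_T(u,w)\le t$ for every edge $uw$ of $G$. The stretch index $\sigma(G)$ is the least $t$ for which $G$ admits a tree $t$-spanner. Pendant vertices are the vertices of degree $1$. A vertex is universal in a graph if it is adjacent to all other vertices of that graph. A graph is Class 1 if its edges can be properly colored with $\Delta(G)$ colors. -}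

module Defs where

open import Data.Nat using (ℕ; zero; suc; _+_; _≤_; _⊔_)
open import Data.Fin using (Fin; zero; suc)
open import Data.Bool using (Bool; true; false; if_then_else_)
open import Data.List using (List; []; _∷_; _++_; length)
open import Data.List.Relation.Unary.Linked using (Linked)
open import Data.List.Relation.Unary.Unique.Propositional using (Unique)
open import Data.Product using (Σ; _×_; ∃)
open import Data.Empty using (⊥)
open import Relation.Nullary using (¬_)
open import Relation.Binary.PropositionalEquality using (_≡_; _≢_)

record Graph (n : ℕ) : Set where
  field
    adj    : Fin n → Fin n → Bool
    sym    : ∀ u v → adj u v ≡ adj v u
    irrefl : ∀ v → adj v v ≡ false
open Graph public

Adj : ∀ {n} → Graph n → Fin n → Fin n → Set
Adj G u v = adj G u v ≡ true

data Walk {n} (G : Graph n) : Fin n → Fin n → ℕ → Set where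
  here : ∀ {v} → Walk G v v 0
  step : ∀ {u w v k} → Adj G u w → Walk G w v k → Walk G u v (suc k)

Connected : ∀ {n} → Graph n → Set
Connected G = ∀ u v → ∃ λ k → Walk G u v k

DistLe : ∀ {n} → Graph n → Fin n → Fin n → ℕ → Set
DistLe G u v t = ∃ λ k → k ≤ t × Walk G u v k

IsCycle : ∀ {n} → Graph n → List (Fin n) → Set
IsCycle G [] = ⊥
IsCycle G (v ∷ vs) = 2 ≤ length vs × Unique (v ∷ vs) × Linked (Adj G) (v ∷ vs ++ v ∷ [])

Acyclic : ∀ {n} → Graph n → Set
Acyclic G = ∀ vs → ¬ IsCycle G vs

IsTree : ∀ {n} → Graph n → Set
IsTree T = Connected T × Acyclic T

Subgraph : ∀ {n} → Graph n → Graph n → Set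
Subgraph T G = ∀ u v → Adj T u v → Adj G u v

IsTreeSpanner : ∀ {n} → Graph n → ℕ → Graph n → Set
IsTreeSpanner G t T = Subgraph T G × IsTree T × (∀ u w → Adj G u w → DistLe T u w t)

HasTreeSpanner : ∀ {n} → Graph n → ℕ → Set
HasTreeSpanner G t = Σ (Graph _) λ T → IsTreeSpanner G t T

StretchIndexIs : ∀ {n} → Graph n → ℕ → Set
StretchIndexIs G s = HasTreeSpanner G s × (∀ t → HasTreeSpanner G t → s ≤ t)

-- Split graph with partition (X,Y): inX v = true iff v ∈ X;
-- X a clique, Y independent, X a maximal clique.
IsSplitPartition : ∀ {n} → Graph n → (Fin n → Bool) → Set
IsSplitPartition G inX =
  (∀ u v → inX u ≡ true → inX v ≡ true → u ≢ v → Adj G u v) ×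
  (∀ u v → inX u ≡ false → inX v ≡ false → ¬ Adj G u v) ×
  (∀ y → inX y ≡ false → ¬ (∀ x → inX x ≡ true → Adj G y x))

countFin : ∀ {n} → (Fin n → Bool) → ℕ
countFin {zero} f = 0
countFin {suc n} f = (if f zero then 1 else 0) + countFin (λ i → f (suc i))

maxFin : ∀ {n} → (Fin n → ℕ) → ℕ
maxFin {zero} f = 0
maxFin {suc n} f = f zero ⊔ maxFin (λ i → f (suc i))

deg : ∀ {n} → Graph n → Fin n → ℕ
deg G v = countFin (adj G v)

maxDeg : ∀ {n} → Graph n → ℕ
maxDeg G = maxFin (deg G)

Pendant : ∀ {n} → Graph n → Fin n → Set
Pendant G v = deg G v ≡ 1

UniversalInNonPendant : ∀ {n} → Graph n → Fin n → Set
UniversalInNonPendant G a =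
  ¬ Pendant G a × (∀ u → u ≢ a → ¬ Pendant G u → Adj G a u)

InA : ∀ {n} → Graph n → Fin n → Set
InA G a = deg G a ≡ maxDeg G × UniversalInNonPendant G a

ProperEdgeColouring : ∀ {n} → Graph n → (k : ℕ) → (Fin n → Fin n → Fin k) → Set
ProperEdgeColouring G k c =
  (∀ u v → Adj G u v → c u v ≡ c v u) ×
  (∀ u v w → Adj G u v → Adj G u w → v ≢ w → c u v ≢ c u w)

Class1 : ∀ {n} → Graph n → Set
Class1 G = Σ (Fin _ → Fin _ → Fin (maxDeg G)) λ c → ProperEdgeColouring G (maxDeg G) c

-- Let T be a tree 2-spanner of G.  As T is acyclic and any two vertices of the clique X are
-- at distance at most 2 in T, some c ∈ X is joined in T to all of X ∖ {c}; excluding cycles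
-- of length at most 6 in T then shows that every vertex with two neighbours is adjacent to c
-- in G.  Since G is not a tree, c is not pendant, so c is adjacent to every other non-pendant
-- vertex and no two pendant vertices are adjacent.  The N non-pendant vertices are c and its
-- non-pendant neighbours, so N ≤ deg c + 1 ≤ Δ(G) when deg c < Δ(G), and N ≤ deg c = Δ(G)
-- otherwise, because then c ∈ A has a pendant neighbour.  Finally, when N ≤ Δ(G), colouring
-- an edge uv between non-pendant vertices by r u + r v mod N (r the rank among the non-pendant
-- vertices) and each pendant edge by a colour left free at its non-pendant end uses Δ(G) colours.

module Submission where

open import Defs hiding (sym)
open import Data.Bool using (Bool; true; false; if_then_else_; not; _∧_)
open import Data.Bool.Properties using (∧-comm; ∧-zeroʳ; ¬-not) renaming (_≟_ to _≟ᵇ_)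
open import Data.Empty using (⊥; ⊥-elim)
open import Data.List using ([]; _∷_)
open import Data.List.Relation.Unary.All using ([]; _∷_)
open import Data.List.Relation.Unary.AllPairs using ([]; _∷_)
open import Data.List.Relation.Unary.Linked using ([-]; _∷_)
open import Data.Fin as Fin using (Fin; zero; suc; toℕ; fromℕ<)
import Data.Fin.Properties as Finₚ
open import Data.Fin.Properties using (toℕ-fromℕ<; any?)
open import Data.Maybe as Maybe using (Maybe; just; nothing; maybe)
open import Data.Maybe.Properties using (map-injective)
open import Data.Nat using (ℕ; zero; suc; _+_; _∸_; _≤_; _<_; z≤n; s≤s; _≟_; _≤?_; _<?_; NonZero; >-nonZero)
open import Data.Nat.DivMod using (m%n<n; m<n⇒m%n≡m)
open import Data.Nat.Properties
open import Data.Product using (Σ; _×_; _,_; proj₁; proj₂)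
open import Data.Sum using (_⊎_; inj₁; inj₂)
open import Function using (_∘_)
open import Relation.Binary.Definitions using (tri<; tri≈; tri>)
open import Relation.Binary.PropositionalEquality
open import Relation.Nullary using (¬_; Dec; yes; no; does)
open import Relation.Nullary.Decidable using (dec-true; dec-false; decidable-stable; ¬?; _×-dec_)

∧-true⁻ˡ : ∀ {a b} → (a ∧ b) ≡ true → a ≡ true
∧-true⁻ˡ {true} _ = refl

∧-true⁻ʳ : ∀ {a b} → (a ∧ b) ≡ true → b ≡ true
∧-true⁻ʳ {true} e = e

∧-true⁺ : ∀ {a b} → a ≡ true → b ≡ true → (a ∧ b) ≡ true
∧-true⁺ refl refl = refl

not-true⁻ : ∀ {a} → not a ≡ true → a ≡ false
not-true⁻ {false} _ = refl

true≢false : ∀ {a} → a ≡ true → a ≢ false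
true≢false refl ()

does-true⁻ : ∀ {A : Set} (a? : Dec A) → does a? ≡ true → A
does-true⁻ (yes a) _ = a

not-does-false⁻ : ∀ {A : Set} (a? : Dec A) → not (does a?) ≡ false → A
not-does-false⁻ (yes a) _ = a

not-does-true⁻ : ∀ {A : Set} (a? : Dec A) → not (does a?) ≡ true → ¬ A
not-does-true⁻ (no ¬a) _ = ¬a

countFin-cong : ∀ {n} {f g : Fin n → Bool} → (∀ i → f i ≡ g i) → countFin f ≡ countFin g
countFin-cong {zero}  f≗g = refl
countFin-cong {suc n} f≗g =
  cong₂ _+_ (cong (λ b → if b then 1 else 0) (f≗g zero)) (countFin-cong (f≗g ∘ suc))

countFin-split : ∀ {n} (f g : Fin n → Bool) →
  countFin f ≡ countFin (λ i → f i ∧ g i) + countFin (λ i → f i ∧ not (g i))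
countFin-split {zero}  f g = refl
countFin-split {suc n} f g with f zero | g zero
... | true  | true  = cong suc (countFin-split (f ∘ suc) (g ∘ suc))
... | true  | false = trans (cong suc (countFin-split (f ∘ suc) (g ∘ suc))) (sym (+-suc _ _))
... | false | _     = countFin-split (f ∘ suc) (g ∘ suc)

countFin-mono : ∀ {n} {f g : Fin n → Bool} →
  (∀ i → f i ≡ true → g i ≡ true) → countFin f ≤ countFin g
countFin-mono {zero}          f⊆g = z≤n
countFin-mono {suc n} {f} {g} f⊆g with f zero in f0 | g zero in g0
... | true  | true  = s≤s (countFin-mono (f⊆g ∘ suc))
... | true  | false = ⊥-elim (true≢false (f⊆g zero f0) g0)
... | false | true  = m≤n⇒m≤1+n (countFin-mono (f⊆g ∘ suc))
... | false | false = countFin-mono (f⊆g ∘ suc)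

countFin-mono-< : ∀ {n} {f g : Fin n → Bool} → (∀ i → f i ≡ true → g i ≡ true) →
  ∀ a → f a ≡ false → g a ≡ true → countFin f < countFin g
countFin-mono-< {suc n} {f} {g} f⊆g zero fa ga rewrite fa | ga = s≤s (countFin-mono (f⊆g ∘ suc))
countFin-mono-< {suc n} {f} {g} f⊆g (suc a) fa ga with f zero in f0 | g zero in g0
... | true  | true  = s≤s (countFin-mono-< (f⊆g ∘ suc) a fa ga)
... | true  | false = ⊥-elim (true≢false (f⊆g zero f0) g0)
... | false | true  = m≤n⇒m≤1+n (countFin-mono-< (f⊆g ∘ suc) a fa ga)
... | false | false = countFin-mono-< (f⊆g ∘ suc) a fa ga

countFin-pos : ∀ {n} {f : Fin n → Bool} a → f a ≡ true → 0 < countFin f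
countFin-pos {suc n} {f} zero    fa rewrite fa = s≤s z≤n
countFin-pos {suc n} {f} (suc a) fa with f zero
... | true  = s≤s z≤n
... | false = countFin-pos a fa

countFin-≥2 : ∀ {n} {f : Fin n → Bool} a b → a ≢ b → f a ≡ true → f b ≡ true → 2 ≤ countFin f
countFin-≥2 {suc n} {f} zero    zero    a≢b fa fb = ⊥-elim (a≢b refl)
countFin-≥2 {suc n} {f} zero    (suc b) a≢b fa fb rewrite fa = s≤s (countFin-pos b fb)
countFin-≥2 {suc n} {f} (suc a) zero    a≢b fa fb rewrite fb = s≤s (countFin-pos a fa)
countFin-≥2 {suc n} {f} (suc a) (suc b) a≢b fa fb with f zero
... | true  = m≤n⇒m≤1+n (countFin-≥2 a b (a≢b ∘ cong suc) fa fb)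
... | false = countFin-≥2 a b (a≢b ∘ cong suc) fa fb

countFin-pos⁻ : ∀ {n} {f : Fin n → Bool} → 0 < countFin f → Σ (Fin n) λ a → f a ≡ true
countFin-pos⁻ {suc n} {f} pos with f zero in f0
... | true  = zero , f0
... | false with countFin-pos⁻ {f = f ∘ suc} pos
...   | a , fa = suc a , fa

countFin-≥2⁻ : ∀ {n} {f : Fin n → Bool} → 2 ≤ countFin f →
  Σ (Fin n) λ a → Σ (Fin n) λ b → a ≢ b × f a ≡ true × f b ≡ true
countFin-≥2⁻ {suc n} {f} two with f zero in f0
countFin-≥2⁻ {suc n} {f} (s≤s pos) | true with countFin-pos⁻ {f = f ∘ suc} pos
... | b , fb = zero , suc b , (λ ()) , f0 , fb
countFin-≥2⁻ {suc n} {f} two | false with countFin-≥2⁻ {f = f ∘ suc} two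
... | a , b , a≢b , fa , fb = suc a , suc b , a≢b ∘ Finₚ.suc-injective , fa , fb

countFin-≤1 : ∀ {n} {f : Fin n → Bool} →
  (∀ a b → f a ≡ true → f b ≡ true → a ≡ b) → countFin f ≤ 1
countFin-≤1 {f = f} unique with countFin f ≤? 1
... | yes ≤1 = ≤1
... | no  ≰1 with countFin-≥2⁻ {f = f} (≰⇒> ≰1)
...   | a , b , a≢b , fa , fb = ⊥-elim (a≢b (unique a b fa fb))

maxFin-ub : ∀ {n} (f : Fin n → ℕ) i → f i ≤ maxFin f
maxFin-ub f zero    = m≤m⊔n _ _
maxFin-ub f (suc i) = ≤-trans (maxFin-ub (f ∘ suc) i) (m≤n⊔m _ _)

rank : ∀ {n} → (Fin n → Bool) → Fin n → ℕ
rank f v = countFin (λ i → f i ∧ does (i Fin.<? v))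

∧-<?-irrefl : ∀ {n} b (v : Fin n) → (b ∧ does (v Fin.<? v)) ≡ false
∧-<?-irrefl b v = trans (cong (b ∧_) (dec-false (v Fin.<? v) (Finₚ.<-irrefl refl))) (∧-zeroʳ b)

rank-< : ∀ {n} (f : Fin n → Bool) v → f v ≡ true → rank f v < countFin f
rank-< f v fv = countFin-mono-< (λ _ → ∧-true⁻ˡ) v (∧-<?-irrefl (f v) v) fv

rank-mono-< : ∀ {n} (f : Fin n → Bool) u v → f u ≡ true → u Fin.< v → rank f u < rank f v
rank-mono-< f u v fu u<v =
  countFin-mono-< below u (∧-<?-irrefl (f u) u) (∧-true⁺ fu (dec-true (u Fin.<? v) u<v))
  where
  below : ∀ i → (f i ∧ does (i Fin.<? u)) ≡ true → (f i ∧ does (i Fin.<? v)) ≡ true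
  below i e = ∧-true⁺ (∧-true⁻ˡ e)
    (dec-true (i Fin.<? v) (Finₚ.<-trans (does-true⁻ (i Fin.<? u) (∧-true⁻ʳ e)) u<v))

rank-injective : ∀ {n} (f : Fin n → Bool) u v → f u ≡ true → f v ≡ true →
  rank f u ≡ rank f v → u ≡ v
rank-injective f u v fu fv eq with Finₚ.<-cmp u v
... | tri< u<v _ _ = ⊥-elim (<-irrefl eq (rank-mono-< f u v fu u<v))
... | tri≈ _ u≡v _ = u≡v
... | tri> _ _ v<u = ⊥-elim (<-irrefl (sym eq) (rank-mono-< f v u fv v<u))

nth : ∀ {n} → (Fin n → Bool) → ℕ → Maybe (Fin n)
nth {zero}  f j       = nothing
nth {suc n} f j       with f zero
nth {suc n} f zero    | true  = just zero
nth {suc n} f (suc j) | true  = Maybe.map suc (nth (f ∘ suc) j)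
nth {suc n} f j       | false = Maybe.map suc (nth (f ∘ suc) j)

nth-just : ∀ {n} (f : Fin n → Bool) j → j < countFin f →
  Σ (Fin n) λ i → nth f j ≡ just i × f i ≡ true
nth-just {suc n} f j       j<     with f zero in f0
nth-just {suc n} f zero    j<       | true = zero , refl , f0
nth-just {suc n} f (suc j) (s≤s j<) | true with nth-just (f ∘ suc) j j<
... | i , eq , fi = suc i , cong (Maybe.map suc) eq , fi
nth-just {suc n} f j       j<       | false with nth-just (f ∘ suc) j j<
... | i , eq , fi = suc i , cong (Maybe.map suc) eq , fi

private
  map-suc-just⁻ : ∀ {n} (m : Maybe (Fin n)) {i} → Maybe.map Fin.suc m ≡ just (Fin.suc i) → m ≡ just i
  map-suc-just⁻ m eq = map-injective Finₚ.suc-injective {m} {just _} eq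

  map-suc≢just-zero : ∀ {n} (m : Maybe (Fin n)) → Maybe.map Fin.suc m ≢ just Fin.zero
  map-suc≢just-zero (just _) ()
  map-suc≢just-zero nothing  ()

nth-injective : ∀ {n} (f : Fin n → Bool) j j' {i} → nth f j ≡ just i → nth f j' ≡ just i → j ≡ j'
nth-injective {suc n} f j       j'       p    q    with f zero
nth-injective {suc n} f zero    zero     p    q    | true = refl
nth-injective {suc n} f zero    (suc j') refl q    | true =
  ⊥-elim (map-suc≢just-zero (nth (f ∘ suc) j') q)
nth-injective {suc n} f (suc j) zero     p    refl | true =
  ⊥-elim (map-suc≢just-zero (nth (f ∘ suc) j) p)
nth-injective {suc n} f (suc j) (suc j') {zero}  p q | true =
  ⊥-elim (map-suc≢just-zero (nth (f ∘ suc) j) p)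
nth-injective {suc n} f (suc j) (suc j') {suc i} p q | true = cong suc
  (nth-injective (f ∘ suc) j j' (map-suc-just⁻ (nth (f ∘ suc) j) p) (map-suc-just⁻ (nth (f ∘ suc) j') q))
nth-injective {suc n} f j j' {zero}  p q | false =
  ⊥-elim (map-suc≢just-zero (nth (f ∘ suc) j) p)
nth-injective {suc n} f j j' {suc i} p q | false =
  nth-injective (f ∘ suc) j j' (map-suc-just⁻ (nth (f ∘ suc) j) p) (map-suc-just⁻ (nth (f ∘ suc) j') q)

module CyclicAddition (N : ℕ) where

  wrap : ℕ → ℕ
  wrap s with s <? N
  ... | yes _ = s
  ... | no  _ = s ∸ N

  infixl 6 _⊕_
  _⊕_ : ℕ → ℕ → ℕ
  a ⊕ b = wrap (a + b)

  ⊕-< : ∀ {a b} → a < N → b < N → a ⊕ b < N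
  ⊕-< {a} {b} a<N b<N with a + b <? N
  ... | yes a+b<N = a+b<N
  ... | no  a+b≮N = +-cancelʳ-< N _ _
    (subst (_< N + N) (sym (m∸n+n≡m (≮⇒≥ a+b≮N))) (+-mono-< a<N b<N))

  ⊕-comm : ∀ a b → a ⊕ b ≡ b ⊕ a
  ⊕-comm a b = cong wrap (+-comm a b)

  private
    wrap-overflow : ∀ a {b c} → N ≤ a + c → a + b ≡ a + c ∸ N → N ≤ c
    wrap-overflow a {b} {c} N≤a+c e = subst (N ≤_) b+N≡c (m≤n+m N b)
      where
      b+N≡c : b + N ≡ c
      b+N≡c = +-cancelˡ-≡ a _ _ (begin
        a + (b + N)   ≡⟨ sym (+-assoc a b N) ⟩
        a + b + N     ≡⟨ cong (_+ N) e ⟩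
        a + c ∸ N + N ≡⟨ m∸n+n≡m N≤a+c ⟩
        a + c         ∎)
        where open ≡-Reasoning

  ⊕-cancelˡ : ∀ a {b c} → b < N → c < N → a ⊕ b ≡ a ⊕ c → b ≡ c
  ⊕-cancelˡ a {b} {c} b<N c<N eq with a + b <? N | a + c <? N
  ... | yes _ | yes _ = +-cancelˡ-≡ a _ _ eq
  ... | no ¬p | no ¬q = +-cancelˡ-≡ a _ _ (∸-cancelʳ-≡ (≮⇒≥ ¬p) (≮⇒≥ ¬q) eq)
  ... | yes _ | no ¬q = ⊥-elim (<⇒≱ c<N (wrap-overflow a (≮⇒≥ ¬q) eq))
  ... | no ¬p | yes _ = ⊥-elim (<⇒≱ b<N (wrap-overflow a (≮⇒≥ ¬p) (sym eq)))

adj-sym : ∀ {n} (G : Graph n) {u v} → Adj G u v → Adj G v u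
adj-sym G {u} {v} e = trans (Graph.sym G v u) e

adj-irrefl : ∀ {n} (G : Graph n) {u v} → Adj G u v → u ≢ v
adj-irrefl G {u} e refl = true≢false e (Graph.irrefl G u)

deg≤maxDeg : ∀ {n} (G : Graph n) v → deg G v ≤ maxDeg G
deg≤maxDeg G = maxFin-ub (deg G)

adj⇒deg≥1 : ∀ {n} (G : Graph n) {v w} → Adj G v w → 1 ≤ deg G v
adj⇒deg≥1 G {v} {w} vw = countFin-pos {f = adj G v} w vw

TwoNeighbours : ∀ {n} → Graph n → Fin n → Set
TwoNeighbours {n} G v = Σ (Fin n) λ a → Σ (Fin n) λ b → a ≢ b × Adj G v a × Adj G v b

TwoNeighbours⇒deg≥2 : ∀ {n} (G : Graph n) {v} → TwoNeighbours G v → 2 ≤ deg G v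
TwoNeighbours⇒deg≥2 G (a , b , a≢b , va , vb) = countFin-≥2 a b a≢b va vb

deg≥2⇒TwoNeighbours : ∀ {n} (G : Graph n) {v} → 2 ≤ deg G v → TwoNeighbours G v
deg≥2⇒TwoNeighbours G = countFin-≥2⁻

pendant⇒¬TwoNeighbours : ∀ {n} (G : Graph n) {v} → Pendant G v → ¬ TwoNeighbours G v
pendant⇒¬TwoNeighbours G p two = <-irrefl (sym p) (TwoNeighbours⇒deg≥2 G two)

pendant-neighbour-unique : ∀ {n} (G : Graph n) {v a b} → Pendant G v → Adj G v a → Adj G v b → a ≡ b
pendant-neighbour-unique G {a = a} {b} p va vb with a Fin.≟ b
... | yes a≡b = a≡b
... | no  a≢b = ⊥-elim (pendant⇒¬TwoNeighbours G p (a , b , a≢b , va , vb))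

connected⇒neighbour : ∀ {n} (G : Graph n) → Connected G → ∀ {u v} → u ≢ v → Σ (Fin n) (Adj G u)
connected⇒neighbour G conn {u} {v} u≢v with conn u v
... | zero  , here         = ⊥-elim (u≢v refl)
... | suc _ , step {w = w} uw _ = w , uw

adjacent-pendants-cover : ∀ {n} (G : Graph n) → Connected G → ∀ {u v} → Adj G u v →
  Pendant G u → Pendant G v → ∀ w → w ≡ u ⊎ w ≡ v
adjacent-pendants-cover G conn {u} {v} uv pu pv w = reach (proj₂ (conn u w)) (inj₁ refl)
  where
  closed : ∀ {x y} → Adj G x y → x ≡ u ⊎ x ≡ v → y ≡ u ⊎ y ≡ v
  closed xy (inj₁ refl) = inj₂ (pendant-neighbour-unique G pu xy uv)
  closed xy (inj₂ refl) = inj₁ (pendant-neighbour-unique G pv xy (adj-sym G uv))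
  reach : ∀ {x y k} → Walk G x y k → x ≡ u ⊎ x ≡ v → y ≡ u ⊎ y ≡ v
  reach here         s = s
  reach (step xz zy) s = reach zy (closed xz s)

ℕ-colouring⇒Class1 : ∀ {n} (G : Graph n) (col : Fin n → Fin n → ℕ) → 0 < maxDeg G →
  (∀ u v → Adj G u v → col u v ≡ col v u) →
  (∀ u v w → Adj G u v → Adj G u w → v ≢ w → col u v ≢ col u w) →
  (∀ u v → Adj G u v → col u v < maxDeg G) →
  Class1 G
ℕ-colouring⇒Class1 G col Δ>0 col-sym col-proper col-< = colour , colour-sym , colour-proper
  where
  instance
    Δ≢0 : NonZero (maxDeg G)
    Δ≢0 = >-nonZero Δ>0

  colour : Fin _ → Fin _ → Fin (maxDeg G)
  colour u v = fromℕ< (m%n<n (col u v) (maxDeg G))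

  toℕ-colour : ∀ {u v} → Adj G u v → toℕ (colour u v) ≡ col u v
  toℕ-colour {u} {v} uv = trans (toℕ-fromℕ< _) (m<n⇒m%n≡m (col-< u v uv))

  colour-sym : ∀ u v → Adj G u v → colour u v ≡ colour v u
  colour-sym u v uv = cong (λ c → fromℕ< (m%n<n c (maxDeg G))) (col-sym u v uv)

  colour-proper : ∀ u v w → Adj G u v → Adj G u w → v ≢ w → colour u v ≢ colour u w
  colour-proper u v w uv uw v≢w eq =
    col-proper u v w uv uw v≢w (trans (sym (toℕ-colour uv)) (trans (cong toℕ eq) (toℕ-colour uw)))

-- Core edges uv get colour r u ⊕ r v.  At a core vertex u the colours below N left free by
-- them are r u ⊕ r w for the core non-neighbours w of u (u itself included); after these come
-- N, N + 1, …, and the pendant edges at u, ranked, take the free colours in this order.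
module CoreColouring {n} (G : Graph n) (core : Fin n → Bool)
  (noncore-pendant : ∀ v → core v ≡ false → Pendant G v)
  (noncore-independent : ∀ u v → Adj G u v → core u ≡ false → core v ≡ false → ⊥)
  (core-small : countFin core ≤ maxDeg G) where

  N : ℕ
  N = countFin core

  open CyclicAddition N

  r : Fin n → ℕ
  r = rank core

  r⊕r-< : ∀ {u v} → core u ≡ true → core v ≡ true → r u ⊕ r v < N
  r⊕r-< {u} {v} cu cv = ⊕-< (rank-< core u cu) (rank-< core v cv)

  r⊕r-cancelˡ : ∀ u {v w} → core v ≡ true → core w ≡ true → r u ⊕ r v ≡ r u ⊕ r w → v ≡ w
  r⊕r-cancelˡ u {v} {w} cv cw eq =
    rank-injective core v w cv cw (⊕-cancelˡ (r u) (rank-< core v cv) (rank-< core w cw) eq)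

  freeAt : Fin n → Fin n → Bool
  freeAt u w = core w ∧ not (adj G u w)

  pendantAt : Fin n → Fin n → Bool
  pendantAt u w = adj G u w ∧ not (core w)

  M : Fin n → ℕ
  M u = countFin (freeAt u)

  -- The default 0 is never used: nth (freeAt u) j succeeds for j < M u.
  freeColourBy : ∀ u j → Dec (j < M u) → ℕ
  freeColourBy u j (yes _) = maybe (λ w → r u ⊕ r w) 0 (nth (freeAt u) j)
  freeColourBy u j (no  _) = N + (j ∸ M u)

  freeColour : Fin n → ℕ → ℕ
  freeColour u j = freeColourBy u j (j <? M u)

  data FreeColourView (u : Fin n) (j : ℕ) : Set where
    low  : ∀ w → freeAt u w ≡ true → nth (freeAt u) j ≡ just w →
           freeColour u j ≡ r u ⊕ r w → FreeColourView u j
    high : M u ≤ j → freeColour u j ≡ N + (j ∸ M u) → FreeColourView u j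

  freeColour-view : ∀ u j → FreeColourView u j
  freeColour-view u j = view (j <? M u) refl
    where
    view : (j<M? : Dec (j < M u)) → freeColour u j ≡ freeColourBy u j j<M? → FreeColourView u j
    view (no j≮M) fc≡ = high (≮⇒≥ j≮M) fc≡
    view (yes j<M) fc≡ with nth-just (freeAt u) j j<M
    ... | w , nth≡w , fw = low w fw nth≡w (trans fc≡ (cong (maybe (λ w → r u ⊕ r w) 0) nth≡w))

  low≢high : ∀ {u w} k → core u ≡ true → core w ≡ true → r u ⊕ r w ≢ N + k
  low≢high {u} {w} k cu cw eq = <⇒≱ (r⊕r-< cu cw) (subst (N ≤_) (sym eq) (m≤m+n N k))

  coreNeighbours : Fin n → ℕ
  coreNeighbours u = countFin (λ w → adj G u w ∧ core w)

  deg-split : ∀ u → deg G u ≡ coreNeighbours u + countFin (pendantAt u)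
  deg-split u = countFin-split (adj G u) core

  N-split : ∀ u → N ≡ coreNeighbours u + M u
  N-split u = trans (countFin-split core (adj G u))
                    (cong (_+ M u) (countFin-cong (λ w → ∧-comm (core w) (adj G u w))))

  freeColour-< : ∀ {u j} → core u ≡ true → j < countFin (pendantAt u) → freeColour u j < maxDeg G
  freeColour-< {u} {j} cu j<P with freeColour-view u j
  ... | low w fw _ fc≡ = subst (_< maxDeg G) (sym fc≡) (<-≤-trans (r⊕r-< cu (∧-true⁻ˡ fw)) core-small)
  ... | high M≤j fc≡ = subst (_< maxDeg G) (sym fc≡) (begin-strict
    N + (j ∸ M u)                             ≡⟨ cong (_+ (j ∸ M u)) (N-split u) ⟩
    coreNeighbours u + M u + (j ∸ M u)        ≡⟨ +-assoc (coreNeighbours u) (M u) _ ⟩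
    coreNeighbours u + (M u + (j ∸ M u))      ≡⟨ cong (coreNeighbours u +_) (m+[n∸m]≡n M≤j) ⟩
    coreNeighbours u + j                      <⟨ +-monoʳ-< (coreNeighbours u) j<P ⟩
    coreNeighbours u + countFin (pendantAt u) ≡⟨ sym (deg-split u) ⟩
    deg G u                                   ≤⟨ deg≤maxDeg G u ⟩
    maxDeg G                                  ∎)
    where open ≤-Reasoning

  freeColour-fresh : ∀ {u v} j → core u ≡ true → core v ≡ true → Adj G u v → freeColour u j ≢ r u ⊕ r v
  freeColour-fresh {u} {v} j cu cv uv eq with freeColour-view u j
  ... | low w fw _ fc≡ =
    true≢false uv (subst (λ x → adj G u x ≡ false) w≡v (not-true⁻ (∧-true⁻ʳ fw)))
    where
    w≡v : w ≡ v
    w≡v = r⊕r-cancelˡ u (∧-true⁻ˡ fw) cv (trans (sym fc≡) eq)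
  ... | high _ fc≡ = low≢high _ cu cv (trans (sym eq) fc≡)

  freeColour-injective : ∀ {u} j j' → core u ≡ true → freeColour u j ≡ freeColour u j' → j ≡ j'
  freeColour-injective {u} j j' cu eq with freeColour-view u j | freeColour-view u j'
  ... | low w fw nth≡w fc≡ | low w' fw' nth≡w' fc≡' =
    nth-injective (freeAt u) j j' nth≡w (subst (λ x → nth (freeAt u) j' ≡ just x) (sym w≡w') nth≡w')
    where
    w≡w' : w ≡ w'
    w≡w' = r⊕r-cancelˡ u (∧-true⁻ˡ fw) (∧-true⁻ˡ fw') (trans (sym fc≡) (trans eq fc≡'))
  ... | high M≤j fc≡ | high M≤j' fc≡' =
    ∸-cancelʳ-≡ M≤j M≤j' (+-cancelˡ-≡ N _ _ (trans (sym fc≡) (trans eq fc≡')))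
  ... | low w fw _ fc≡ | high _ fc≡' = ⊥-elim (low≢high _ cu (∧-true⁻ˡ fw) (trans (sym fc≡) (trans eq fc≡')))
  ... | high _ fc≡ | low w' fw' _ fc≡' =
    ⊥-elim (low≢high _ cu (∧-true⁻ˡ fw') (trans (sym fc≡') (trans (sym eq) fc≡)))

  colour : Fin n → Fin n → ℕ
  colour u v =
    if core u then (if core v then r u ⊕ r v else freeColour u (rank (pendantAt u) v))
    else freeColour v (rank (pendantAt v) u)

  pendantAt-true : ∀ {u v} → Adj G u v → core v ≡ false → pendantAt u v ≡ true
  pendantAt-true uv cv = ∧-true⁺ uv (cong not cv)

  colour-sym : ∀ u v → Adj G u v → colour u v ≡ colour v u
  colour-sym u v uv with core u in cu | core v in cv
  ... | true  | true  = ⊕-comm (r u) (r v)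
  ... | true  | false = refl
  ... | false | true  = refl
  ... | false | false = ⊥-elim (noncore-independent u v uv cu cv)

  colour-< : ∀ u v → Adj G u v → colour u v < maxDeg G
  colour-< u v uv with core u in cu | core v in cv
  ... | true  | true  = <-≤-trans (r⊕r-< cu cv) core-small
  ... | true  | false = freeColour-< cu (rank-< (pendantAt u) v (pendantAt-true uv cv))
  ... | false | true  = freeColour-< cv (rank-< (pendantAt v) u (pendantAt-true (adj-sym G uv) cu))
  ... | false | false = ⊥-elim (noncore-independent u v uv cu cv)

  colour-proper : ∀ u v w → Adj G u v → Adj G u w → v ≢ w → colour u v ≢ colour u w
  colour-proper u v w uv uw v≢w eq with core u in cu
  ... | false = v≢w (pendant-neighbour-unique G (noncore-pendant u cu) uv uw)
  ... | true with core v in cv | core w in cw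
  ...   | true  | true  = v≢w (r⊕r-cancelˡ u cv cw eq)
  ...   | true  | false = freeColour-fresh _ cu cv uv (sym eq)
  ...   | false | true  = freeColour-fresh _ cu cw uw eq
  ...   | false | false = v≢w (rank-injective (pendantAt u) v w
    (pendantAt-true uv cv) (pendantAt-true uw cw) (freeColour-injective _ _ cu eq))

few-core-vertices⇒Class1 : ∀ {n} (G : Graph n) (core : Fin n → Bool) →
  (∀ v → core v ≡ false → Pendant G v) →
  (∀ u v → Adj G u v → core u ≡ false → core v ≡ false → ⊥) →
  countFin core ≤ maxDeg G → 0 < maxDeg G → Class1 G
few-core-vertices⇒Class1 G core noncore-pendant noncore-independent core-small Δ>0 =
  ℕ-colouring⇒Class1 G colour Δ>0 colour-sym colour-proper colour-<
  where open CoreColouring G core noncore-pendant noncore-independent core-small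

Within2 : ∀ {n} → Graph n → Fin n → Fin n → Set
Within2 {n} T u w = Adj T u w ⊎ Σ (Fin n) λ m → Adj T u m × Adj T m w

DistLe2⇒Within2 : ∀ {n} (T : Graph n) {u w} → u ≢ w → DistLe T u w 2 → Within2 T u w
DistLe2⇒Within2 T u≢w (_ , _ , here)                  = ⊥-elim (u≢w refl)
DistLe2⇒Within2 T u≢w (_ , _ , step uw here)          = inj₁ uw
DistLe2⇒Within2 T u≢w (_ , _ , step um (step mw here)) = inj₂ (_ , um , mw)
DistLe2⇒Within2 T u≢w (_ , s≤s (s≤s ()) , step _ (step _ (step _ _)))

stretch2⇒¬acyclic : ∀ {n} (G : Graph n) → Connected G → StretchIndexIs G 2 → ¬ Acyclic G
stretch2⇒¬acyclic G conn (_ , least) acyclic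
  with least 1 (G , (λ _ _ uv → uv) , (conn , acyclic) , λ _ _ uv → 1 , ≤-refl , step uv here)
... | s≤s ()

¬acyclic⇒vertex : ∀ {n} (G : Graph n) → ¬ Acyclic G → Fin n
¬acyclic⇒vertex {zero}  G cyclic = ⊥-elim (cyclic λ { [] () ; (() ∷ _) })
¬acyclic⇒vertex {suc n} G cyclic = zero

one-branch-vertex⇒acyclic : ∀ {n} (G : Graph n) →
  (∀ a b → a ≢ b → TwoNeighbours G a → TwoNeighbours G b → ⊥) → Acyclic G
one-branch-vertex⇒acyclic G ≤1 [] ()
one-branch-vertex⇒acyclic G ≤1 (_ ∷ []) (() , _)
one-branch-vertex⇒acyclic G ≤1 (_ ∷ _ ∷ []) (s≤s () , _)
one-branch-vertex⇒acyclic G ≤1 (v ∷ v₁ ∷ v₂ ∷ [])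
  (_ , ((v≢v₁ ∷ v≢v₂ ∷ []) ∷ (v₁≢v₂ ∷ []) ∷ _) , (vv₁ ∷ v₁v₂ ∷ v₂v ∷ [-])) =
  ≤1 v₁ v₂ v₁≢v₂ (v , v₂ , v≢v₂ , adj-sym G vv₁ , v₁v₂) (v₁ , v , ≢-sym v≢v₁ , adj-sym G v₁v₂ , v₂v)
one-branch-vertex⇒acyclic G ≤1 (v ∷ v₁ ∷ v₂ ∷ v₃ ∷ _)
  (_ , ((v≢v₁ ∷ v≢v₂ ∷ _) ∷ (v₁≢v₂ ∷ v₁≢v₃ ∷ _) ∷ _) , (vv₁ ∷ v₁v₂ ∷ v₂v₃ ∷ _)) =
  ≤1 v₁ v₂ v₁≢v₂ (v , v₂ , v≢v₂ , adj-sym G vv₁ , v₁v₂) (v₁ , v₃ , v₁≢v₃ , adj-sym G v₁v₂ , v₂v₃)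

module Forest {n} (T : Graph n) (acyclic : Acyclic T) where

  private
    ne : ∀ {a b} → Adj T a b → a ≢ b
    ne = adj-irrefl T

    en : ∀ {a b} → Adj T a b → b ≢ a
    en = ≢-sym ∘ adj-irrefl T

  -- Only the chords of each cycle need to be shown distinct: consecutive vertices are adjacent.
  ¬cycle₃ : ∀ {a b c} → Adj T a b → Adj T b c → Adj T c a → ⊥
  ¬cycle₃ ab bc ca = acyclic (_ ∷ _ ∷ _ ∷ [])
    (s≤s (s≤s z≤n) , ((ne ab ∷ en ca ∷ []) ∷ (ne bc ∷ []) ∷ [] ∷ []) , (ab ∷ bc ∷ ca ∷ [-]))

  ¬cycle₄ : ∀ {a b c d} → a ≢ c → b ≢ d →
    Adj T a b → Adj T b c → Adj T c d → Adj T d a → ⊥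
  ¬cycle₄ a≢c b≢d ab bc cd da = acyclic (_ ∷ _ ∷ _ ∷ _ ∷ [])
    (s≤s (s≤s z≤n) ,
     ((ne ab ∷ a≢c ∷ en da ∷ []) ∷ (ne bc ∷ b≢d ∷ []) ∷ (ne cd ∷ []) ∷ [] ∷ []) ,
     (ab ∷ bc ∷ cd ∷ da ∷ [-]))

  ¬cycle₅ : ∀ {a b c d e} → a ≢ c → a ≢ d → b ≢ d → b ≢ e → c ≢ e →
    Adj T a b → Adj T b c → Adj T c d → Adj T d e → Adj T e a → ⊥
  ¬cycle₅ a≢c a≢d b≢d b≢e c≢e ab bc cd de ea = acyclic (_ ∷ _ ∷ _ ∷ _ ∷ _ ∷ [])
    (s≤s (s≤s z≤n) ,
     ((ne ab ∷ a≢c ∷ a≢d ∷ en ea ∷ []) ∷ (ne bc ∷ b≢d ∷ b≢e ∷ []) ∷ (ne cd ∷ c≢e ∷ []) ∷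
      (ne de ∷ []) ∷ [] ∷ []) ,
     (ab ∷ bc ∷ cd ∷ de ∷ ea ∷ [-]))

  ¬cycle₆ : ∀ {a b c d e f} → a ≢ c → a ≢ d → a ≢ e → b ≢ d → b ≢ e → b ≢ f →
    c ≢ e → c ≢ f → d ≢ f →
    Adj T a b → Adj T b c → Adj T c d → Adj T d e → Adj T e f → Adj T f a → ⊥
  ¬cycle₆ a≢c a≢d a≢e b≢d b≢e b≢f c≢e c≢f d≢f ab bc cd de ef fa =
    acyclic (_ ∷ _ ∷ _ ∷ _ ∷ _ ∷ _ ∷ [])
    (s≤s (s≤s z≤n) ,
     ((ne ab ∷ a≢c ∷ a≢d ∷ a≢e ∷ en fa ∷ []) ∷ (ne bc ∷ b≢d ∷ b≢e ∷ b≢f ∷ []) ∷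
      (ne cd ∷ c≢e ∷ c≢f ∷ []) ∷ (ne de ∷ d≢f ∷ []) ∷ (ne ef ∷ []) ∷ [] ∷ []) ,
     (ab ∷ bc ∷ cd ∷ de ∷ ef ∷ fa ∷ [-]))

  adjacent-middle-via-edge : ∀ {x₁ x₂ m x} → x₁ ≢ x₂ → ¬ Adj T x₁ x₂ → Adj T x₁ m → Adj T m x₂ →
    x ≢ x₂ → x ≢ m → Adj T x x₁ → Within2 T x x₂ → Adj T m x
  adjacent-middle-via-edge x₁≢x₂ ¬x₁x₂ x₁m mx₂ x≢x₂ x≢m xx₁ (inj₁ xx₂) =
    ⊥-elim (¬cycle₄ x₁≢x₂ (≢-sym x≢m) x₁m mx₂ (adj-sym T xx₂) xx₁)
  adjacent-middle-via-edge {x₁} {m = m} x₁≢x₂ ¬x₁x₂ x₁m mx₂ x≢x₂ x≢m xx₁ (inj₂ (b , xb , bx₂))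
    with b Fin.≟ x₁ | b Fin.≟ m
  ... | yes refl | _        = ⊥-elim (¬x₁x₂ bx₂)
  ... | no  _    | yes refl = adj-sym T xb
  ... | no  b≢x₁ | no  b≢m  =
    ⊥-elim (¬cycle₅ x₁≢x₂ (≢-sym b≢x₁) (≢-sym b≢m) (≢-sym x≢m) (≢-sym x≢x₂)
                    x₁m mx₂ (adj-sym T bx₂) (adj-sym T xb) xx₁)

  adjacent-middle : ∀ {x₁ x₂ m x} → x₁ ≢ x₂ → ¬ Adj T x₁ x₂ → Adj T x₁ m → Adj T m x₂ →
    x ≢ x₁ → x ≢ x₂ → x ≢ m → Within2 T x x₁ → Within2 T x x₂ → Adj T m x
  adjacent-middle x₁≢x₂ ¬x₁x₂ x₁m mx₂ x≢x₁ x≢x₂ x≢m (inj₁ xx₁) near₂ =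
    adjacent-middle-via-edge x₁≢x₂ ¬x₁x₂ x₁m mx₂ x≢x₂ x≢m xx₁ near₂
  adjacent-middle x₁≢x₂ ¬x₁x₂ x₁m mx₂ x≢x₁ x≢x₂ x≢m near₁ (inj₁ xx₂) =
    adjacent-middle-via-edge (≢-sym x₁≢x₂) (¬x₁x₂ ∘ adj-sym T)
      (adj-sym T mx₂) (adj-sym T x₁m) x≢x₁ x≢m xx₂ near₁
  adjacent-middle {x₁} {x₂} {m} x₁≢x₂ ¬x₁x₂ x₁m mx₂ x≢x₁ x≢x₂ x≢m (inj₂ (a , xa , ax₁)) (inj₂ (b , xb , bx₂))
    with a Fin.≟ m | b Fin.≟ m | a Fin.≟ x₂ | b Fin.≟ x₁ | a Fin.≟ b
  ... | yes refl | _        | _        | _        | _        = adj-sym T xa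
  ... | no _     | yes refl | _        | _        | _        = adj-sym T xb
  ... | no _     | no _     | yes refl | _        | _        = ⊥-elim (¬x₁x₂ (adj-sym T ax₁))
  ... | no _     | no _     | no _     | yes refl | _        = ⊥-elim (¬x₁x₂ bx₂)
  ... | no a≢m   | no _     | no _     | no _     | yes refl =
    ⊥-elim (¬cycle₄ x₁≢x₂ (≢-sym a≢m) x₁m mx₂ (adj-sym T bx₂) ax₁)
  ... | no a≢m   | no b≢m   | no a≢x₂  | no b≢x₁  | no a≢b   =
    ⊥-elim (¬cycle₆ x₁≢x₂ (≢-sym b≢x₁) (≢-sym x≢x₁) (≢-sym b≢m) (≢-sym x≢m) (≢-sym a≢m)
                    (≢-sym x≢x₂) (≢-sym a≢x₂) (≢-sym a≢b)
                    x₁m mx₂ (adj-sym T bx₂) (adj-sym T xb) xa ax₁)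

  -- Either x₁ itself is the centre, or a vertex x₂ of S not adjacent to x₁ is reached
  -- through a middle vertex m, and every other vertex of S is adjacent to m.
  star-centre : (S : Fin n → Bool) → (∀ x y → S x ≡ true → S y ≡ true → x ≢ y → Within2 T x y) →
    ∀ x₁ → S x₁ ≡ true → Σ (Fin n) λ c → ∀ x → S x ≡ true → x ≢ c → Adj T c x
  star-centre S near x₁ Sx₁
    with any? (λ x → (S x ≟ᵇ true) ×-dec ¬? (x Fin.≟ x₁) ×-dec ¬? (adj T x₁ x ≟ᵇ true))
  ... | no none = x₁ , λ x Sx x≢x₁ →
    decidable-stable (adj T x₁ x ≟ᵇ true) (λ ¬x₁x → none (x , Sx , x≢x₁ , ¬x₁x))
  ... | yes (x₂ , Sx₂ , x₂≢x₁ , ¬x₁x₂) with near x₁ x₂ Sx₁ Sx₂ (≢-sym x₂≢x₁)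
  ...   | inj₁ x₁x₂ = ⊥-elim (¬x₁x₂ x₁x₂)
  ...   | inj₂ (m , x₁m , mx₂) = m , centre
    where
    centre : ∀ x → S x ≡ true → x ≢ m → Adj T m x
    centre x Sx x≢m with x Fin.≟ x₁ | x Fin.≟ x₂
    ... | yes refl | _        = adj-sym T x₁m
    ... | no _     | yes refl = mx₂
    ... | no x≢x₁  | no x≢x₂  = adjacent-middle (≢-sym x₂≢x₁) ¬x₁x₂ x₁m mx₂ x≢x₁ x≢x₂ x≢m
      (near x x₁ Sx Sx₁ x≢x₁) (near x x₂ Sx Sx₂ x≢x₂)

split-clique-inhabited : ∀ {n} {G : Graph n} {inX} → IsSplitPartition G inX → Fin n →
  Σ (Fin n) λ x → inX x ≡ true
split-clique-inhabited {inX = inX} (_ , _ , maximal) v with any? (λ x → inX x ≟ᵇ true)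
... | yes x∈X = x∈X
... | no  none = ⊥-elim (maximal v (¬-not (none ∘ (v ,_))) (λ x x∈X → ⊥-elim (none (x , x∈X))))

module SplitTreeSpanner {n} (G : Graph n) (inX : Fin n → Bool) (split : IsSplitPartition G inX)
  (T : Graph n) (T⊆G : Subgraph T G) (acyclic : Acyclic T)
  (stretch : ∀ u w → Adj G u w → DistLe T u w 2) where

  private
    clique : ∀ u v → inX u ≡ true → inX v ≡ true → u ≢ v → Adj G u v
    clique = proj₁ split

    independent : ∀ u v → inX u ≡ false → inX v ≡ false → ¬ Adj G u v
    independent = proj₁ (proj₂ split)

    maximal : ∀ y → inX y ≡ false → ¬ (∀ x → inX x ≡ true → Adj G y x)
    maximal = proj₂ (proj₂ split)

  open Forest T acyclic

  within2 : ∀ {u w} → Adj G u w → Within2 T u w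
  within2 uw = DistLe2⇒Within2 T (adj-irrefl G uw) (stretch _ _ uw)

  neighbour-of-Y∈X : ∀ {u v} → inX u ≡ false → Adj G u v → inX v ≡ true
  neighbour-of-Y∈X {u} {v} u∉X uv with inX v in v∈X?
  ... | true  = refl
  ... | false = ⊥-elim (independent u v u∉X v∈X? uv)

  dominating⇒∈X : ∀ {c} → (∀ x → inX x ≡ true → x ≢ c → Adj T c x) → inX c ≡ true
  dominating⇒∈X {c} centre with inX c in c∈X?
  ... | true  = refl
  ... | false = ⊥-elim (maximal c c∈X? λ x x∈X → T⊆G c x (centre x x∈X λ { refl → true≢false x∈X c∈X? }))

  clique-centre : Fin n → Σ (Fin n) λ c → inX c ≡ true × (∀ x → inX x ≡ true → x ≢ c → Adj T c x)
  clique-centre v with split-clique-inhabited {G = G} split v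
  ... | x₁ , x₁∈X with star-centre inX (λ x y x∈X y∈X x≢y → within2 (clique x y x∈X y∈X x≢y)) x₁ x₁∈X
  ...   | c , centre = c , dominating⇒∈X centre , centre

  module _ {c} (c∈X : inX c ≡ true) (centre : ∀ x → inX x ≡ true → x ≢ c → Adj T c x) where

    private
      no-two-T-neighbours-off-centre : ∀ {u t t'} → u ≢ c → t ≢ t' →
        inX t ≡ true → inX t' ≡ true → t ≢ c → t' ≢ c → Adj T u t → Adj T u t' → ⊥
      no-two-T-neighbours-off-centre u≢c t≢t' t∈X t'∈X t≢c t'≢c ut ut' =
        ¬cycle₄ u≢c t≢t' ut (adj-sym T (centre _ t∈X t≢c)) (centre _ t'∈X t'≢c) (adj-sym T ut')

      Y-neighbour-route : ∀ {u z} → inX u ≡ false → inX z ≡ true → z ≢ c → Adj G u z →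
        Adj G u c ⊎ Adj T u z
      Y-neighbour-route u∉X z∈X z≢c uz with within2 uz
      ... | inj₁ uzᵀ = inj₂ uzᵀ
      ... | inj₂ (t , ut , tz) with t Fin.≟ c
      ...   | yes refl = inj₁ (T⊆G _ _ ut)
      ...   | no  t≢c  = ⊥-elim (¬cycle₃ tz (adj-sym T (centre _ z∈X z≢c))
                                  (centre _ (neighbour-of-Y∈X u∉X (T⊆G _ _ ut)) t≢c))

    TwoNeighbours⇒adj-centre : ∀ {u} → u ≢ c → TwoNeighbours G u → Adj G u c
    TwoNeighbours⇒adj-centre {u} u≢c (v , w , v≢w , uv , uw) with inX u in u∈X? | v Fin.≟ c | w Fin.≟ c
    ... | true  | _        | _        = clique u c u∈X? c∈X u≢c
    ... | false | yes refl | _        = uv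
    ... | false | no  _    | yes refl = uw
    ... | false | no  v≢c  | no  w≢c
        with Y-neighbour-route u∈X? (neighbour-of-Y∈X u∈X? uv) v≢c uv
           | Y-neighbour-route u∈X? (neighbour-of-Y∈X u∈X? uw) w≢c uw
    ...   | inj₁ uc  | _        = uc
    ...   | inj₂ _   | inj₁ uc  = uc
    ...   | inj₂ uvᵀ | inj₂ uwᵀ = ⊥-elim (no-two-T-neighbours-off-centre u≢c v≢w
      (neighbour-of-Y∈X u∈X? uv) (neighbour-of-Y∈X u∈X? uw) v≢c w≢c uvᵀ uwᵀ)

nonPendantᵇ : ∀ {n} → Graph n → Fin n → Bool
nonPendantᵇ G v = not (does (deg G v ≟ 1))

nonPendantᵇ-false⁻ : ∀ {n} (G : Graph n) v → nonPendantᵇ G v ≡ false → Pendant G v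
nonPendantᵇ-false⁻ G v = not-does-false⁻ (deg G v ≟ 1)

nonPendantᵇ-true⁻ : ∀ {n} (G : Graph n) v → nonPendantᵇ G v ≡ true → ¬ Pendant G v
nonPendantᵇ-true⁻ G v = not-does-true⁻ (deg G v ≟ 1)

nonPendantᵇ-true : ∀ {n} (G : Graph n) v → ¬ Pendant G v → nonPendantᵇ G v ≡ true
nonPendantᵇ-true G v ¬p = cong not (dec-false (deg G v ≟ 1) ¬p)

nonPendantᵇ-false : ∀ {n} (G : Graph n) v → Pendant G v → nonPendantᵇ G v ≡ false
nonPendantᵇ-false G v p = cong not (dec-true (deg G v ≟ 1) p)

universal⇒nonPendant-count : ∀ {n} (G : Graph n) {c} → UniversalInNonPendant G c →
  countFin (nonPendantᵇ G) ≡ countFin (λ i → adj G c i ∧ nonPendantᵇ G i) + 1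
universal⇒nonPendant-count G {c} (¬pc , universal) = trans
  (countFin-split (nonPendantᵇ G) (adj G c))
  (cong₂ _+_ (countFin-cong (λ i → ∧-comm (nonPendantᵇ G i) (adj G c i)))
             (≤-antisym (countFin-≤1 (λ a b a∉ b∉ → trans (only-c a a∉) (sym (only-c b b∉))))
                        (countFin-pos c c∉)))
  where
  only-c : ∀ a → (nonPendantᵇ G a ∧ not (adj G c a)) ≡ true → a ≡ c
  only-c a e with a Fin.≟ c
  ... | yes a≡c = a≡c
  ... | no  a≢c = ⊥-elim (true≢false (universal a a≢c (nonPendantᵇ-true⁻ G a (∧-true⁻ˡ e)))
                                     (not-true⁻ (∧-true⁻ʳ e)))
  c∉ : (nonPendantᵇ G c ∧ not (adj G c c)) ≡ true
  c∉ = ∧-true⁺ (nonPendantᵇ-true G c ¬pc) (cong not (Graph.irrefl G c))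

universal-nonPendant-count≤maxDeg : ∀ {n} (G : Graph n) {c} → UniversalInNonPendant G c →
  (deg G c ≡ maxDeg G → Σ (Fin n) λ p → Pendant G p × Adj G c p) →
  countFin (nonPendantᵇ G) ≤ maxDeg G
universal-nonPendant-count≤maxDeg G {c} universal pendant-if-max =
  subst (_≤ maxDeg G) (sym (universal⇒nonPendant-count G universal)) D+1≤Δ
  where
  D P : ℕ
  D = countFin (λ i → adj G c i ∧ nonPendantᵇ G i)
  P = countFin (λ i → adj G c i ∧ not (nonPendantᵇ G i))

  deg≡D+P : deg G c ≡ D + P
  deg≡D+P = countFin-split (adj G c) (nonPendantᵇ G)

  D+1≤Δ : D + 1 ≤ maxDeg G
  D+1≤Δ with deg G c ≟ maxDeg G
  ... | yes deg≡Δ with pendant-if-max deg≡Δ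
  ...   | p , pp , cp = subst (D + 1 ≤_) (trans (sym deg≡D+P) deg≡Δ)
    (+-monoʳ-≤ D (countFin-pos p (∧-true⁺ cp (cong not (nonPendantᵇ-false G p pp)))))
  D+1≤Δ | no deg≢Δ = ≤-trans (+-monoˡ-≤ 1 (subst (D ≤_) (sym deg≡D+P) (m≤m+n D P)))
                             (subst (_≤ maxDeg G) (+-comm 1 (deg G c)) (≤∧≢⇒< (deg≤maxDeg G c) deg≢Δ))

module Hub {n} (G : Graph n) (conn : Connected G) (cyclic : ¬ Acyclic G) {c}
  (hub : ∀ {u} → u ≢ c → TwoNeighbours G u → Adj G u c) where

  hub-¬pendant : ¬ Pendant G c
  hub-¬pendant pc = cyclic (one-branch-vertex⇒acyclic G λ a b a≢b two-a two-b →
    a≢b (pendant-neighbour-unique G pc (adj-sym G (to-hub two-a)) (adj-sym G (to-hub two-b))))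
    where
    to-hub : ∀ {a} → TwoNeighbours G a → Adj G a c
    to-hub {a} two with a Fin.≟ c
    ... | yes refl = ⊥-elim (pendant⇒¬TwoNeighbours G pc two)
    ... | no  a≢c  = hub a≢c two

  hub-universal : UniversalInNonPendant G c
  hub-universal = hub-¬pendant , λ u u≢c ¬pu → adj-sym G (hub u≢c (deg≥2⇒TwoNeighbours G
    (≤∧≢⇒< (adj⇒deg≥1 G (proj₂ (connected⇒neighbour G conn u≢c))) (≢-sym ¬pu))))

  pendants-nonadjacent : ∀ {u v} → Adj G u v → Pendant G u → Pendant G v → ⊥
  pendants-nonadjacent uv pu pv with adjacent-pendants-cover G conn uv pu pv c
  ... | inj₁ refl = hub-¬pendant pu
  ... | inj₂ refl = hub-¬pendant pv

corollary3 : ∀ {n} (G : Graph n) (inX : Fin n → Bool)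
    → Connected G
    → IsSplitPartition G inX
    → StretchIndexIs G 2
    → (∀ a → InA G a → Σ (Fin n) λ p → Pendant G p × Adj G a p)
    → Class1 G
corollary3 G inX conn split σ₂@((T , T⊆G , (_ , acyclic) , stretch) , _) A-pendant =
  few-core-vertices⇒Class1 G (nonPendantᵇ G) (nonPendantᵇ-false⁻ G) pendants-independent
    count≤Δ (≤-trans (countFin-pos c (nonPendantᵇ-true G c hub-¬pendant)) count≤Δ)
  where
  open SplitTreeSpanner G inX split T T⊆G acyclic stretch

  cyclic : ¬ Acyclic G
  cyclic = stretch2⇒¬acyclic G conn σ₂

  centre : Σ (Fin _) λ c → inX c ≡ true × (∀ x → inX x ≡ true → x ≢ c → Adj T c x)
  centre = clique-centre (¬acyclic⇒vertex G cyclic)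

  c : Fin _
  c = proj₁ centre

  open Hub G conn cyclic (TwoNeighbours⇒adj-centre (proj₁ (proj₂ centre)) (proj₂ (proj₂ centre)))

  count≤Δ : countFin (nonPendantᵇ G) ≤ maxDeg G
  count≤Δ = universal-nonPendant-count≤maxDeg G hub-universal
    (λ deg≡Δ → A-pendant c (deg≡Δ , hub-universal))

  pendants-independent : ∀ u v → Adj G u v → nonPendantᵇ G u ≡ false → nonPendantᵇ G v ≡ false → ⊥
  pendants-independent u v uv u∉ v∉ =
    pendants-nonadjacent uv (nonPendantᵇ-false⁻ G u u∉) (nonPendantᵇ-false⁻ G v v∉)
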